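{- Let $\widetilde\Delta$ be a connected graph, $N$ a group, and $\ell$ a reductive voltage assignment on $\widetilde\Delta$ with values in $N$. Let $\widetilde\Gamma$ be the lift of $\widetilde\Delta$ with respect to $\ell$, $\Delta=\widetilde\Delta/\sim$ and $\Gamma=\widetilde\Gamma/\sim$. Define $\ell'$ on darts of $\Delta$ by $\ell'([u],[v])=\ell(u,v)$. Then $\ell'$ is a well-defined voltage assignment and $\Gamma$ is the lift of $\Delta$ with respect to $\ell'$, where the vertex $[(v,n)]$ of $\Gamma$ is identified with $([v],n)$.
   Context: Graphs are simple; $\perp$ denotes adjacency; a dart is an ordered pair of adjacent vertices. A voltage assignment is a map $\ell$ from darts to $N$ with $\ell(u,v)=\ell(v,u)^{ -1}$; the lift has vertex set $V\times N$ with $(u,m)\perp(v,n)$ iff $u\perp v$ and $\ell(u,v)=mn^{ -1}$. In a graph, $x\sim y$ iff $x,y$ have the same neighbours; the reduct $\Delta/\sim$ has the $\sim$-classes $[x]$ as vertices, two classes being adjacent iff representatives are adjacent. $\ell$ is reductive if for all vertices $u,v,w$ with $u\sim v$ and $v\perp w$ one has $\ell(w,u)=\ell(w,v)$. -}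

module Defs where

open import Level using (Level; _⊔_; suc)
open import Data.Product using (Σ; ∃; _×_; _,_)
open import Relation.Binary.PropositionalEquality using (_≡_)
open import Relation.Binary.Construct.Closure.ReflexiveTransitive using (Star)
open import Relation.Nullary using (¬_)
open import Algebra.Bundles using (Group)

_⟺_ : ∀ {a b} → Set a → Set b → Set (a ⊔ b)
A ⟺ B = (A → B) × (B → A)

-- A graph whose vertex "set" is a setoid (needed to represent quotients
-- such as reducts, since Agda has no quotient types): a carrier, an
-- equality of vertices, and an adjacency relation.
record SGraph (a e r : Level) : Set (suc (a ⊔ e ⊔ r)) where
  field
    Vtx  : Set a
    _≈ᵥ_ : Vtx → Vtx → Set e
    _⊥_  : Vtx → Vtx → Set r

open SGraph public

ofGraph : ∀ {a r} {V : Set a} → (V → V → Set r) → SGraph a a r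
ofGraph {V = V} adj = record { Vtx = V ; _≈ᵥ_ = _≡_ ; _⊥_ = adj }

IsSimple : ∀ {a r} {V : Set a} → (V → V → Set r) → Set (a ⊔ r)
IsSimple {V = V} _⊥_ = (∀ u v → u ⊥ v → v ⊥ u) × (∀ v → ¬ (v ⊥ v))

Connected : ∀ {a r} {V : Set a} → (V → V → Set r) → Set (a ⊔ r)
Connected {V = V} _⊥_ = ∀ u v → Star _⊥_ u v

SameNbrs : ∀ {a e r} (G : SGraph a e r) → Vtx G → Vtx G → Set (a ⊔ r)
SameNbrs G x y = ∀ z → (_⊥_ G z x ⟺ _⊥_ G z y)

-- The reduct G/∼ : vertices are ∼-classes (represented by vertices, with
-- ∼ as the equality); two classes are adjacent iff some representatives are.
Reduct : ∀ {a e r} → SGraph a e r → SGraph a (a ⊔ r) (a ⊔ r)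
Reduct G = record
  { Vtx  = Vtx G
  ; _≈ᵥ_ = SameNbrs G
  ; _⊥_  = λ x y → ∃ λ x' → ∃ λ y' →
             SameNbrs G x x' × SameNbrs G y y' × _⊥_ G x' y'
  }

module _ {c ℓ} (N : Group c ℓ) where
  open Group N renaming (Carrier to |N|)

  -- Voltage assignment: values on darts, with ℓ(v,u) = ℓ(u,v)⁻¹, and
  -- well defined w.r.t. the vertex equality of the graph.
  -- (ℓ is given as a function on all ordered pairs; only its values on
  -- darts matter.)
  IsVoltage : ∀ {a e r} (G : SGraph a e r) → (Vtx G → Vtx G → |N|) → Set (a ⊔ e ⊔ r ⊔ ℓ)
  IsVoltage G λ' =
    (∀ u u' v v' → _≈ᵥ_ G u u' → _≈ᵥ_ G v v' → _⊥_ G u v → λ' u v ≈ λ' u' v')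
    × (∀ u v → _⊥_ G u v → λ' v u ≈ (λ' u v) ⁻¹)

  Reductive : ∀ {a e r} (G : SGraph a e r) → (Vtx G → Vtx G → |N|) → Set (a ⊔ r ⊔ ℓ)
  Reductive G λ' = ∀ u v w → SameNbrs G u v → _⊥_ G v w → λ' w u ≈ λ' w v

  Lift : ∀ {a e r} (G : SGraph a e r) → (Vtx G → Vtx G → |N|) → SGraph (a ⊔ c) (e ⊔ ℓ) (r ⊔ ℓ)
  Lift G λ' = record
    { Vtx  = Vtx G × |N|
    ; _≈ᵥ_ = λ { (u , m) (v , n) → _≈ᵥ_ G u v × m ≈ n }
    ; _⊥_  = λ { (u , m) (v , n) → _⊥_ G u v × λ' u v ≈ m ∙ n ⁻¹ }
    }

IsIso : ∀ {a e r a' e' r'} (G : SGraph a e r) (H : SGraph a' e' r') →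
        (Vtx G → Vtx H) → Set (a ⊔ e ⊔ r ⊔ a' ⊔ e' ⊔ r')
IsIso G H f =
  (∀ x y → _≈ᵥ_ G x y ⟺ _≈ᵥ_ H (f x) (f y))
  × (∀ y → ∃ λ x → _≈ᵥ_ H (f x) y)
  × (∀ x y → _⊥_ G x y ⟺ _⊥_ H (f x) (f y))

{-# OPTIONS --safe #-}
-- In the lift, (u , m) and (v , n) have the same neighbours exactly when u ∼ v and m = n.
-- The neighbours of (u , m) are the vertices (w , ℓ(w,u) m) with w ⊥ u, so equal
-- neighbourhoods give u ∼ v; as u is not isolated (connectedness plus one edge),
-- reductivity ℓ(w,u) = ℓ(w,v) then forces m = n, and conversely reductivity lets the
-- voltage condition pass from u to v. Together with ℓ(v,u) = ℓ(u,v)⁻¹, reductivity also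
-- makes ℓ constant on pairs of classes, so the adjacency of Γ is that of the lift of Δ.
module Submission where

open import Defs
open import Level using (_⊔_)
open import Data.Product using (_×_; ∃; _,_; proj₁; proj₂)
open import Algebra.Bundles using (Group)
open import Function using (id)
open import Relation.Binary.Definitions using (Symmetric)
open import Relation.Binary.Construct.Closure.ReflexiveTransitive using (Star; ε; _◅_)
import Algebra.Properties.Group as GroupProperties
import Relation.Binary.Reasoning.Setoid as SetoidReasoning

module _ {a e r} (G : SGraph a e r) where

  SameNbrs-refl : ∀ x → SameNbrs G x x
  SameNbrs-refl x z = id , id

  SameNbrs-sym : ∀ {x y} → SameNbrs G x y → SameNbrs G y x
  SameNbrs-sym x∼y z = proj₂ (x∼y z) , proj₁ (x∼y z)

module _ {c ℓ} (N : Group c ℓ) where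
  open Group N
  open GroupProperties N using (//-rightDividesˡ; ∙-cancelˡ)
  open SetoidReasoning setoid

  x∙y//z≈x⇒y≈z : ∀ x y z → (x ∙ y) // z ≈ x → y ≈ z
  x∙y//z≈x⇒y≈z x y z eq = ∙-cancelˡ x y z (begin
    x ∙ y               ≈⟨ //-rightDividesˡ z (x ∙ y) ⟨
    ((x ∙ y) // z) ∙ z  ≈⟨ ∙-congʳ eq ⟩
    x ∙ z               ∎)

module _ {a r} {V : Set a} {_⊥_ : V → V → Set r} where
  private
    _∼_ : V → V → Set (a ⊔ r)
    _∼_ = SameNbrs (ofGraph _⊥_)

    ∼-sym : ∀ {u v} → u ∼ v → v ∼ u
    ∼-sym = SameNbrs-sym (ofGraph _⊥_)

    _⊥ᴿ_ : V → V → Set (a ⊔ r)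
    _⊥ᴿ_ = SGraph._⊥_ (Reduct (ofGraph _⊥_))

  ∼-resp-⊥ʳ : ∀ {u v w} → u ∼ v → w ⊥ u → w ⊥ v
  ∼-resp-⊥ʳ {w = w} u∼v = proj₁ (u∼v w)

  module _ (⊥-sym : Symmetric _⊥_) where

    ∼-resp-⊥ˡ : ∀ {u v w} → u ∼ v → u ⊥ w → v ⊥ w
    ∼-resp-⊥ˡ u∼v u⊥w = ⊥-sym (∼-resp-⊥ʳ u∼v (⊥-sym u⊥w))

    reduct-⊥⇒⊥ : ∀ {u v} → u ⊥ᴿ v → u ⊥ v
    reduct-⊥⇒⊥ (u' , v' , u∼u' , v∼v' , u'⊥v') =
      ∼-resp-⊥ʳ (∼-sym v∼v') (∼-resp-⊥ˡ (∼-sym u∼u') u'⊥v')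

    connected⇒no-isolated : Connected _⊥_ → (∃ λ x → ∃ λ y → x ⊥ y) → ∀ u → ∃ λ w → w ⊥ u
    connected⇒no-isolated conn (x , y , x⊥y) u = first-step (conn u x)
      where
      first-step : Star _⊥_ u x → ∃ λ w → w ⊥ u
      first-step ε           = y , ⊥-sym x⊥y
      first-step (u⊥w ◅ _)  = _ , ⊥-sym u⊥w

  module _ {c ℓ} (N : Group c ℓ) (l : V → V → Group.Carrier N) where
    open Group N
    open GroupProperties N using (//-rightDividesʳ)
    open SetoidReasoning setoid

    private
      L : SGraph (a ⊔ c) (a ⊔ ℓ) (r ⊔ ℓ)
      L = Lift N (ofGraph _⊥_) l

    lift-neighbour : ∀ {u w} m → w ⊥ u → SGraph._⊥_ L (w , l w u ∙ m) (u , m)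
    lift-neighbour {u} {w} m w⊥u = w⊥u , sym (//-rightDividesʳ m (l w u))

    lift-∼⇒∼ : ∀ {u m v n} → SameNbrs L (u , m) (v , n) → u ∼ v
    lift-∼⇒∼ {m = m} {n = n} S w =
        (λ w⊥u → proj₁ (proj₁ (S _) (lift-neighbour m w⊥u)))
      , (λ w⊥v → proj₁ (proj₂ (S _) (lift-neighbour n w⊥v)))

    module _ (⊥-sym : Symmetric _⊥_) (red : Reductive N (ofGraph _⊥_) l) where

      l-resp-∼ʳ : ∀ {u v w} → u ∼ v → w ⊥ u → l w u ≈ l w v
      l-resp-∼ʳ {u} {v} {w} u∼v w⊥u = red u v w u∼v (⊥-sym (∼-resp-⊥ʳ u∼v w⊥u))

      lift-∼⇒≈ : ∀ {u m v n w} → w ⊥ u → SameNbrs L (u , m) (v , n) → m ≈ n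
      lift-∼⇒≈ {u} {m} {v} {n} {w} w⊥u S = x∙y//z≈x⇒y≈z N (l w u) m n (begin
        (l w u ∙ m) // n  ≈⟨ proj₂ (proj₁ (S _) (lift-neighbour m w⊥u)) ⟨
        l w v             ≈⟨ l-resp-∼ʳ (lift-∼⇒∼ S) w⊥u ⟨
        l w u             ∎)

      lift-⊥-resp-∼ : ∀ {u m v n x} → u ∼ v → m ≈ n →
                      SGraph._⊥_ L x (u , m) → SGraph._⊥_ L x (v , n)
      lift-⊥-resp-∼ {u} {m} {v} {n} {w , k} u∼v m≈n (w⊥u , eq) =
        ∼-resp-⊥ʳ u∼v w⊥u , (begin
          l w v   ≈⟨ l-resp-∼ʳ u∼v w⊥u ⟨
          l w u   ≈⟨ eq ⟩
          k // m  ≈⟨ ∙-congˡ (⁻¹-cong m≈n) ⟩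
          k // n  ∎)

      lift-∼⇔∼×≈ : (∀ u → ∃ λ w → w ⊥ u) →
                ∀ {u m v n} → SameNbrs L (u , m) (v , n) ⟺ (u ∼ v × m ≈ n)
      lift-∼⇔∼×≈ no-isolated {u} =
          (λ S → lift-∼⇒∼ S , lift-∼⇒≈ (proj₂ (no-isolated u)) S)
        , (λ (u∼v , m≈n) _ →
             lift-⊥-resp-∼ u∼v m≈n , lift-⊥-resp-∼ (∼-sym u∼v) (sym m≈n))

      module _ (vol : IsVoltage N (ofGraph _⊥_) l) where

        l-resp-∼ˡ : ∀ {u v w} → u ∼ v → u ⊥ w → l u w ≈ l v w
        l-resp-∼ˡ {u} {v} {w} u∼v u⊥w = begin
          l u w      ≈⟨ proj₂ vol w u (⊥-sym u⊥w) ⟩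
          l w u ⁻¹   ≈⟨ ⁻¹-cong (l-resp-∼ʳ u∼v (⊥-sym u⊥w)) ⟩
          l w v ⁻¹   ≈⟨ proj₂ vol w v (⊥-sym (∼-resp-⊥ˡ ⊥-sym u∼v u⊥w)) ⟨
          l v w      ∎

        l-resp-∼ : ∀ u u' v v' → u ∼ u' → v ∼ v' → u ⊥ᴿ v → l u v ≈ l u' v'
        l-resp-∼ u u' v v' u∼u' v∼v' u⊥ᴿv =
          trans (l-resp-∼ʳ v∼v' u⊥v) (l-resp-∼ˡ u∼u' (∼-resp-⊥ʳ v∼v' u⊥v))
          where
          u⊥v : u ⊥ v
          u⊥v = reduct-⊥⇒⊥ ⊥-sym u⊥ᴿv

        reduct-voltage : IsVoltage N (Reduct (ofGraph _⊥_)) l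
        reduct-voltage = l-resp-∼ , λ u v u⊥ᴿv → proj₂ vol u v (reduct-⊥⇒⊥ ⊥-sym u⊥ᴿv)

        reduct-lift-⊥⇔lift-reduct-⊥ : ∀ x y →
          SGraph._⊥_ (Reduct L) x y ⟺ SGraph._⊥_ (Lift N (Reduct (ofGraph _⊥_)) l) x y
        reduct-lift-⊥⇔lift-reduct-⊥ (u , m) (v , n) = to , from
          where
          to : SGraph._⊥_ (Reduct L) (u , m) (v , n) → u ⊥ᴿ v × l u v ≈ m // n
          to ((u' , m') , (v' , n') , Su , Sv , (u'⊥v' , eq)) = u⊥ᴿv , (begin
            l u v     ≈⟨ l-resp-∼ u u' v v' (lift-∼⇒∼ Su) (lift-∼⇒∼ Sv) u⊥ᴿv ⟩
            l u' v'   ≈⟨ eq ⟩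
            m' // n'  ≈⟨ ∙-cong (lift-∼⇒≈ v⊥u Su) (⁻¹-cong (lift-∼⇒≈ (⊥-sym v⊥u) Sv)) ⟨
            m // n    ∎)
            where
            u⊥ᴿv : u ⊥ᴿ v
            u⊥ᴿv = u' , v' , lift-∼⇒∼ Su , lift-∼⇒∼ Sv , u'⊥v'
            v⊥u : v ⊥ u
            v⊥u = ⊥-sym (reduct-⊥⇒⊥ ⊥-sym u⊥ᴿv)

          from : u ⊥ᴿ v × l u v ≈ m // n → SGraph._⊥_ (Reduct L) (u , m) (v , n)
          from (u⊥ᴿv , eq) = (u , m) , (v , n) , SameNbrs-refl L _ , SameNbrs-refl L _
                           , (reduct-⊥⇒⊥ ⊥-sym u⊥ᴿv , eq)

        reduct-lift≅lift-reduct : (∀ u → ∃ λ w → w ⊥ u) →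
          IsIso (Reduct L) (Lift N (Reduct (ofGraph _⊥_)) l) id
        reduct-lift≅lift-reduct no-isolated =
            (λ _ _ → lift-∼⇔∼×≈ no-isolated)
          , (λ x → x , (SameNbrs-refl (ofGraph _⊥_) _ , refl))
          , reduct-lift-⊥⇔lift-reduct-⊥

corollary2p5 : ∀ {a r c ℓ} {V : Set a} (_⊥_ : V → V → Set r) (N : Group c ℓ)
    (l : V → V → Group.Carrier N) →
    IsSimple _⊥_ → Connected _⊥_ → (∃ λ u → ∃ λ v → u ⊥ v) →
    IsVoltage N (ofGraph _⊥_) l → Reductive N (ofGraph _⊥_) l →
    IsVoltage N (Reduct (ofGraph _⊥_)) l
    × IsIso (Reduct (Lift N (ofGraph _⊥_) l)) (Lift N (Reduct (ofGraph _⊥_)) l) id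
corollary2p5 _⊥_ N l (⊥-sym′ , _) conn edge vol red =
    reduct-voltage N l ⊥-sym red vol
  , reduct-lift≅lift-reduct N l ⊥-sym red vol (connected⇒no-isolated ⊥-sym conn edge)
  where
  ⊥-sym : Symmetric _⊥_
  ⊥-sym {u} {v} = ⊥-sym′ u v
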